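{- For each deterministic algorithm $A$ for Metric $1$-median that makes $O(n)$ queries on $n$-point inputs, there is a sufficiently small constant $\delta>0$ such that $A$ is not $(\delta\log n)$-approximate; that is, it is not the case that on every $n$-point metric space $(M,d)$ the output $p$ of $A$ satisfies $\sum_{y\in M}d(p,y)\le\delta\log n\cdot\min_{q\in M}\sum_{y\in M}d(q,y)$.
   Context: Metric $1$-median: given an $n$-point metric space $(M,d)$ (the point set $M$ is known to the algorithm, while $d$ is accessible only through queries, each query asking for $d(x,y)$ for some $x,y\in M$, possibly chosen adaptively), output a point $p\in M$. An algorithm is $\gamma(n)$-approximate if on every $n$-point metric space its output $p$ satisfies $\sum_{y\in M}d(p,y)\le\gamma(n)\min_{q\in M}\sum_{y\in M}d(q,y)$. -}

module Defs where

open import Data.Nat as ℕ using (ℕ; zero; suc; NonZero)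
open import Data.Nat.Logarithm using (⌈log₂_⌉)
open import Data.Fin using (Fin; zero; suc)
open import Data.Integer using (+_)
open import Data.Rational using (ℚ; 0ℚ; _+_; _*_; _⊓_; _≤_; _/_)
open import Relation.Binary.PropositionalEquality using (_≡_)

-- A deterministic adaptive query algorithm on the point set Fin n, as a
-- decision tree: either output a point, or query d(x,y) and continue
-- depending on the (rational) answer.
data QueryAlg (n : ℕ) : Set where
  output : Fin n → QueryAlg n
  query  : Fin n → Fin n → (ℚ → QueryAlg n) → QueryAlg n

run : ∀ {n} → QueryAlg n → (Fin n → Fin n → ℚ) → Fin n
run (output p)    d = p
run (query x y k) d = run (k (d x y)) d

queries : ∀ {n} → QueryAlg n → (Fin n → Fin n → ℚ) → ℕ
queries (output p)    d = 0
queries (query x y k) d = suc (queries (k (d x y)) d)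

record IsMetric {n : ℕ} (d : Fin n → Fin n → ℚ) : Set where
  field
    nonneg   : ∀ x y → 0ℚ ≤ d x y
    zero-iff : ∀ x y → d x y ≡ 0ℚ → x ≡ y
    refl-0   : ∀ x → d x x ≡ 0ℚ
    symm     : ∀ x y → d x y ≡ d y x
    triangle : ∀ x y z → d x z ≤ d x y + d y z

sumFin : ∀ {n} → (Fin n → ℚ) → ℚ
sumFin {zero}  f = 0ℚ
sumFin {suc n} f = f zero + sumFin (λ i → f (suc i))

minFin : ∀ {n} .{{_ : NonZero n}} → (Fin n → ℚ) → ℚ
minFin {suc zero}    f = f zero
minFin {suc (suc n)} f = f zero ⊓ minFin {suc n} (λ i → f (suc i))

cost : ∀ {n} → (Fin n → Fin n → ℚ) → Fin n → ℚ
cost d p = sumFin (λ y → d p y)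

opt : ∀ {n} .{{_ : NonZero n}} → (Fin n → Fin n → ℚ) → ℚ
opt d = minFin (λ q → cost d q)

logℚ : ℕ → ℚ
logℚ n = (+ ⌈log₂ n ⌉) / 1

-- The adversary maintains a graph on the n points, with D its shortest-path
-- metric capped at K, where 4^K ≤ n < 4^(K+1), and gives each point z the
-- weight 2 + deg z.  With H x = min_z (D x z + weight z), the distance to the
-- nearest hub, a query (x, y) is answered by min (D x y, H x + H y); the answer
-- is then frozen by joining the hubs of x and y by an edge whose length is the
-- sum of their weights.  As the i-th edge at a point has length at least 2 + i,
-- at most 2^K points lie within graph distance K of any point.  Once the
-- algorithm outputs p, adding K ∸ D p z to the weight of each z keeps every
-- answer valid for the metric min (D x y, H x + H y) and puts every point
-- outside the small ball around p at distance at least K from p.  So p costs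
-- about n K, while the point of least weight costs at most twice the total
-- weight, which is O(n + #queries) = O(n).  Since K ≈ ½ log₂ n, the ratio is
-- Ω(log n).
module Submission where

open import Defs

-- The ℕ operators opened here would clash with the ℚ ones in the statement below.
module _ where
  open import Data.Nat
    using (ℕ; zero; suc; _+_; _*_; _∸_; _^_; _⊓_; _≤_; _<_; _≤?_; _<?_; z≤n; s≤s; NonZero)
  open import Data.Nat.Properties
  open import Data.Nat.Logarithm using (⌈log₂_⌉; ⌈log₂⌉-mono-≤; ⌈log₂2^n⌉≡n)
  open import Data.Nat.Tactic.RingSolver using (solve-∀)
  import Data.Nat.Coprimality as Coprime
  import Data.Integer as ℤ
  import Data.Integer.Properties as ℤ
  open import Data.Rational as ℚ using (ℚ; mkℚ; 0ℚ; 1ℚ; 1/_; ↥_)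
  import Data.Rational.Properties as ℚ
  open import Data.Fin as Fin using (Fin; zero; suc)
  open import Data.Bool using (Bool; true; false; _∨_; if_then_else_)
  open import Data.Empty using (⊥-elim)
  open import Data.Sum using (inj₁; inj₂)
  open import Data.Product using (∃-syntax; _×_; _,_; proj₁; proj₂)
  open import Data.List using (List; []; _∷_; _++_; [_]; length; allFin)
  open import Data.List.Properties using (length-++)
  open import Data.List.Relation.Unary.Any using (here; there)
  import Data.List.Relation.Unary.All as All
  open import Data.List.Membership.Propositional using (_∈_)
  open import Data.List.Membership.Propositional.Properties using (∈-allFin; ∈-++⁺ˡ; ∈-++⁺ʳ)
  import Data.List.Membership.DecPropositional as DecMembership
  open import Data.List.Extrema ≤-totalOrder using (argmin; f[argmin]≤f[xs])
  open import Algebra.Properties.Semiring.Sum +-*-semiring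
    using (sum; sum-syntax; ∑-distrib-+; *-distribˡ-sum; sum-cong-≗)
  open import Relation.Nullary using (Dec; does; yes; no; ¬_)
  open import Relation.Binary.PropositionalEquality hiding ([_])
  open import Function using (_∘_)

  -- Unlike + k / 1 (used by logℚ, see /1≡toℚ) this form computes, so e.g.
  -- NonZero (toℚ (suc k)) is found by instance search.
  toℚ : ℕ → ℚ
  toℚ k = mkℚ (ℤ.+ k) 0 (Coprime.sym (Coprime.1-coprimeTo k))

  /1≡toℚ : ∀ k → ℤ.+ k ℚ./ 1 ≡ toℚ k
  /1≡toℚ k = ℚ.normalize-coprime (Coprime.sym (Coprime.1-coprimeTo k))

  pos*1≡pos : ∀ k → ℤ.+ k ℤ.* ℤ.+ 1 ≡ ℤ.+ k
  pos*1≡pos k = ℤ.*-identityʳ (ℤ.+ k)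

  toℚ-+ : ∀ a b → toℚ (a + b) ≡ toℚ a ℚ.+ toℚ b
  toℚ-+ a b = begin
    toℚ (a + b)                                 ≡⟨ /1≡toℚ (a + b) ⟨
    ℤ.+ (a + b) ℚ./ 1                           ≡⟨ cong (ℚ._/ 1) (cong₂ ℤ._+_ (pos*1≡pos a) (pos*1≡pos b)) ⟨
    (ℤ.+ a ℤ.* ℤ.+ 1 ℤ.+ ℤ.+ b ℤ.* ℤ.+ 1) ℚ./ 1 ≡⟨⟩
    toℚ a ℚ.+ toℚ b                             ∎
    where open ≡-Reasoning

  toℚ-* : ∀ a b → toℚ (a * b) ≡ toℚ a ℚ.* toℚ b
  toℚ-* a b = begin
    toℚ (a * b)              ≡⟨ /1≡toℚ (a * b) ⟨
    ℤ.+ (a * b) ℚ./ 1        ≡⟨ cong (ℚ._/ 1) (ℤ.pos-* a b) ⟩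
    (ℤ.+ a ℤ.* ℤ.+ b) ℚ./ 1  ≡⟨⟩
    toℚ a ℚ.* toℚ b          ∎
    where open ≡-Reasoning

  toℚ-mono-≤ : ∀ {a b} → a ≤ b → toℚ a ℚ.≤ toℚ b
  toℚ-mono-≤ {a} {b} a≤b = ℚ.*≤* (subst₂ ℤ._≤_ (sym (pos*1≡pos a)) (sym (pos*1≡pos b)) (ℤ.+≤+ a≤b))

  toℚ-mono-< : ∀ {a b} → a < b → toℚ a ℚ.< toℚ b
  toℚ-mono-< {a} {b} a<b = ℚ.*<* (subst₂ ℤ._<_ (sym (pos*1≡pos a)) (sym (pos*1≡pos b)) (ℤ.+<+ a<b))

  toℚ-injective : ∀ {a b} → toℚ a ≡ toℚ b → a ≡ b
  toℚ-injective eq = ℤ.+-injective (cong ↥_ eq)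

  sumFin-toℚ : ∀ {n} (f : Fin n → ℕ) → sumFin (toℚ ∘ f) ≡ toℚ (sum f)
  sumFin-toℚ {zero}  f = refl
  sumFin-toℚ {suc n} f = begin
    toℚ (f zero) ℚ.+ sumFin (toℚ ∘ f ∘ suc)  ≡⟨ cong (toℚ (f zero) ℚ.+_) (sumFin-toℚ (f ∘ suc)) ⟩
    toℚ (f zero) ℚ.+ toℚ (sum (f ∘ suc))     ≡⟨ toℚ-+ (f zero) (sum (f ∘ suc)) ⟨
    toℚ (sum f)                              ∎
    where open ≡-Reasoning

  minFin≤ : ∀ {n} .{{_ : NonZero n}} (f : Fin n → ℚ) i → minFin f ℚ.≤ f i
  minFin≤ {suc zero}    f zero    = ℚ.≤-refl
  minFin≤ {suc (suc n)} f zero    = ℚ.p⊓q≤p (f zero) _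
  minFin≤ {suc (suc n)} f (suc i) = ℚ.≤-trans (ℚ.p⊓q≤q (f zero) _) (minFin≤ (f ∘ suc) i)

  ∑-const : ∀ n k → ∑[ i < n ] k ≡ n * k
  ∑-const zero    k = refl
  ∑-const (suc n) k = cong (k +_) (∑-const n k)

  ∑-mono-≤ : ∀ {n} {f g : Fin n → ℕ} → (∀ i → f i ≤ g i) → sum f ≤ sum g
  ∑-mono-≤ {zero}  f≤g = z≤n
  ∑-mono-≤ {suc n} f≤g = +-mono-≤ (f≤g zero) (∑-mono-≤ (f≤g ∘ suc))

  indicator : Bool → ℕ
  indicator true  = 1
  indicator false = 0

  indicator-∨ : ∀ a b → indicator (a ∨ b) ≤ indicator a + indicator b
  indicator-∨ true  b = s≤s z≤n
  indicator-∨ false b = ≤-refl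

  ∑-indicator-≟ : ∀ {n} (b : Fin n) → ∑[ i < n ] indicator (does (i Fin.≟ b)) ≡ 1
  ∑-indicator-≟ {suc n} zero    = cong suc (trans (∑-const n 0) (*-zeroʳ n))
  ∑-indicator-≟ {suc n} (suc b) = ∑-indicator-≟ b

  module _ {n : ℕ} where
    open DecMembership (Fin._≟_ {n}) using (_∈?_)

    ∑-indicator-∈ : (L : List (Fin n)) → ∑[ y < n ] indicator (does (y ∈? L)) ≤ length L
    ∑-indicator-∈ []      = ≤-reflexive (trans (∑-const n 0) (*-zeroʳ n))
    ∑-indicator-∈ (b ∷ L) = begin
      ∑[ y < n ] indicator (does (y ∈? b ∷ L))
        ≤⟨ ∑-mono-≤ (λ y → indicator-∨ (does (y Fin.≟ b)) _) ⟩
      ∑[ y < n ] (indicator (does (y Fin.≟ b)) + indicator (does (y ∈? L)))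
        ≡⟨ ∑-distrib-+ (indicator ∘ does ∘ (Fin._≟ b)) (indicator ∘ does ∘ (_∈? L)) ⟩
      ∑[ y < n ] indicator (does (y Fin.≟ b)) + ∑[ y < n ] indicator (does (y ∈? L))
        ≤⟨ +-mono-≤ (≤-reflexive (∑-indicator-≟ b)) (∑-indicator-∈ L) ⟩
      suc (length L) ∎
      where open ≤-Reasoning

  -- Opaque: conversion checking would otherwise unfold the search through allFin.
  opaque
    argminFin : ∀ {n} → (Fin (suc n) → ℕ) → Fin (suc n)
    argminFin f = argmin f zero (allFin _)

    argminFin-≤ : ∀ {n} (f : Fin (suc n) → ℕ) i → f (argminFin f) ≤ f i
    argminFin-≤ f i = All.lookup (f[argmin]≤f[xs] {f = f} zero (allFin _)) (∈-allFin i)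

  record IsℕMetric {A : Set} (D : A → A → ℕ) : Set where
    field
      symm     : ∀ x y → D x y ≡ D y x
      refl-0   : ∀ x → D x x ≡ 0
      positive : ∀ {x y} → x ≢ y → 0 < D x y
      triangle : ∀ x y z → D x z ≤ D x y + D y z

  toℚ-isMetric : ∀ {n} {D : Fin n → Fin n → ℕ} → IsℕMetric D → IsMetric (λ x y → toℚ (D x y))
  toℚ-isMetric {D = D} isMetric = record
    { nonneg   = λ x y → toℚ-mono-≤ z≤n
    ; zero-iff = zero-iff
    ; refl-0   = λ x → cong toℚ (refl-0 x)
    ; symm     = λ x y → cong toℚ (symm x y)
    ; triangle = λ x y z → subst (toℚ (D x z) ℚ.≤_) (toℚ-+ (D x y) (D y z)) (toℚ-mono-≤ (triangle x y z))
    }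
    where
    open IsℕMetric isMetric
    zero-iff : ∀ x y → toℚ (D x y) ≡ 0ℚ → x ≡ y
    zero-iff x y Dxy≡0 with x Fin.≟ y
    ... | yes x≡y = x≡y
    ... | no  x≢y = ⊥-elim (<-irrefl (sym (toℚ-injective Dxy≡0)) (positive x≢y))

  discrete : ∀ {n} → ℕ → Fin n → Fin n → ℕ
  discrete K x y = if does (x Fin.≟ y) then 0 else K

  discrete-isMetric : ∀ {n} K → 0 < K → IsℕMetric (discrete {n} K)
  discrete-isMetric K 0<K = record { symm = symm′ ; refl-0 = refl-0′ ; positive = positive′ ; triangle = triangle′ }
    where
    symm′ : ∀ x y → discrete K x y ≡ discrete K y x
    symm′ x y with x Fin.≟ y | y Fin.≟ x
    ... | yes _   | yes _   = refl
    ... | no  _   | no  _   = refl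
    ... | yes x≡y | no  y≢x = ⊥-elim (y≢x (sym x≡y))
    ... | no  x≢y | yes y≡x = ⊥-elim (x≢y (sym y≡x))
    refl-0′ : ∀ x → discrete K x x ≡ 0
    refl-0′ x with x Fin.≟ x
    ... | yes _   = refl
    ... | no  x≢x = ⊥-elim (x≢x refl)
    positive′ : ∀ {x y} → x ≢ y → 0 < discrete K x y
    positive′ {x} {y} x≢y with x Fin.≟ y
    ... | yes x≡y = ⊥-elim (x≢y x≡y)
    ... | no  _   = 0<K
    triangle′ : ∀ x y z → discrete K x z ≤ discrete K x y + discrete K y z
    triangle′ x y z with x Fin.≟ z | x Fin.≟ y | y Fin.≟ z
    ... | yes _   | _       | _       = z≤n
    ... | no  _   | no  _   | _       = m≤m+n K _
    ... | no  _   | yes _   | no  _   = ≤-refl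
    ... | no  x≢z | yes x≡y | yes y≡z = ⊥-elim (x≢z (trans x≡y y≡z))

  drop-middle : ∀ x c y y′ z → x + c + z ≤ (x + c + y) + (y′ + c + z)
  drop-middle x c y y′ z = subst (x + c + z ≤_) (rearrange x c y y′ z) (m≤m+n (x + c + z) (y + y′ + c))
    where
    rearrange : ∀ x c y y′ z → x + c + z + (y + y′ + c) ≡ (x + c + y) + (y′ + c + z)
    rearrange = solve-∀

  ⊓-preserves : ∀ (P : ℕ → Set) a b → P a → P b → P (a ⊓ b)
  ⊓-preserves P a b Pa Pb with ⊓-sel a b
  ... | inj₁ a⊓b≡a = subst P (sym a⊓b≡a) Pa
  ... | inj₂ a⊓b≡b = subst P (sym a⊓b≡b) Pb

  ≤-⊓-+ : ∀ {t} a b c → t ≤ a + c → t ≤ b + c → t ≤ a ⊓ b + c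
  ≤-⊓-+ {t} a b c t≤a+c t≤b+c = subst (t ≤_) (sym (+-distribʳ-⊓ c a b)) (⊓-glb t≤a+c t≤b+c)

  ≤-+-⊓ : ∀ {t} a b c → t ≤ a + b → t ≤ a + c → t ≤ a + b ⊓ c
  ≤-+-⊓ {t} a b c t≤a+b t≤a+c = subst (t ≤_) (sym (+-distribˡ-⊓ a b c)) (⊓-glb t≤a+b t≤a+c)

  module _ {A : Set} (D : A → A → ℕ) where

    detour : A → A → ℕ → A → A → ℕ
    detour u v c a b = D a u + c + D v b

    -- The shortest-path metric after joining u and v by an edge of length c.
    addEdge : A → A → ℕ → A → A → ℕ
    addEdge u v c a b = D a b ⊓ (detour u v c a b ⊓ detour v u c a b)

    addEdge≤ : ∀ u v c a b → addEdge u v c a b ≤ D a b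
    addEdge≤ u v c a b = m⊓n≤m _ _

    addEdge≤detour : ∀ u v c a b → addEdge u v c a b ≤ detour u v c a b
    addEdge≤detour u v c a b = ≤-trans (m⊓n≤n _ _) (m⊓n≤m _ _)

    addEdge≤detour′ : ∀ u v c a b → addEdge u v c a b ≤ detour v u c a b
    addEdge≤detour′ u v c a b = ≤-trans (m⊓n≤n _ _) (m⊓n≤n _ _)

  module _ {A : Set} {D : A → A → ℕ} (isMetric : IsℕMetric D) where
    open IsℕMetric isMetric

    detour-symm : ∀ u v c a b → detour D u v c a b ≡ detour D v u c b a
    detour-symm u v c a b = begin
      D a u + c + D v b ≡⟨ cong₂ (λ s t → s + c + t) (symm a u) (symm v b) ⟩
      D u a + c + D b v ≡⟨ reverse (D u a) c (D b v) ⟩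
      D b v + c + D u a ∎
      where
      open ≡-Reasoning
      reverse : ∀ x y z → x + y + z ≡ z + y + x
      reverse = solve-∀

    detour-triangleˡ : ∀ u v c a y b → detour D u v c a b ≤ D a y + detour D u v c y b
    detour-triangleˡ u v c a y b = begin
      D a u + c + D v b           ≤⟨ +-monoˡ-≤ (D v b) (+-monoˡ-≤ c (triangle a y u)) ⟩
      D a y + D y u + c + D v b   ≡⟨ cong (_+ D v b) (+-assoc (D a y) (D y u) c) ⟩
      D a y + (D y u + c) + D v b ≡⟨ +-assoc (D a y) (D y u + c) (D v b) ⟩
      D a y + (D y u + c + D v b) ∎
      where open ≤-Reasoning

    detour-triangleʳ : ∀ u v c a y b → detour D u v c a b ≤ detour D u v c a y + D y b
    detour-triangleʳ u v c a y b = begin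
      D a u + c + D v b           ≤⟨ +-monoʳ-≤ (D a u + c) (triangle v y b) ⟩
      D a u + c + (D v y + D y b) ≡⟨ +-assoc (D a u + c) (D v y) (D y b) ⟨
      D a u + c + D v y + D y b   ∎
      where open ≤-Reasoning

    detour-twice : ∀ u v c a y b → detour D u v c a b ≤ detour D u v c a y + detour D u v c y b
    detour-twice u v c a y b = drop-middle (D a u) c (D v y) (D y u) (D v b)

    ≤-detour-back : ∀ u v c a y b → D a b ≤ detour D u v c a y + detour D v u c y b
    ≤-detour-back u v c a y b = begin
      D a b                                   ≤⟨ triangle a u b ⟩
      D a u + D u b                           ≤⟨ +-monoˡ-≤ (D u b) (m≤m+n (D a u) c) ⟩
      D a u + c + D u b                       ≤⟨ drop-middle (D a u) c (D v y) (D y v) (D u b) ⟩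
      (D a u + c + D v y) + (D y v + c + D u b) ∎
      where open ≤-Reasoning

    addEdge-isMetric : ∀ u v c → 0 < c → IsℕMetric (addEdge D u v c)
    addEdge-isMetric u v c 0<c = record
      { symm     = λ a b → cong₂ _⊓_ (symm a b)
                     (trans (cong₂ _⊓_ (detour-symm u v c a b) (detour-symm v u c a b)) (⊓-comm _ _))
      ; refl-0   = λ a → cong (_⊓ (detour D u v c a a ⊓ detour D v u c a a)) (refl-0 a)
      ; positive = λ a≢b → ⊓-glb (positive a≢b) (⊓-glb (detour-positive u v) (detour-positive v u))
      ; triangle = addEdge-triangle
      }
      where
      E = addEdge D u v c

      detour-positive : ∀ {a b} u v → 0 < detour D u v c a b
      detour-positive {a} {b} u v = ≤-trans 0<c (≤-trans (m≤n+m c (D a u)) (m≤m+n _ (D v b)))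

      addEdge-triangle : ∀ a y b → E a b ≤ E a y + E y b
      addEdge-triangle a y b =
        ≤-⊓-+ (D a y) _ (E y b) viaD (≤-⊓-+ (detour D u v c a y) (detour D v u c a y) (E y b) viaP viaQ)
        where
        split : ∀ {x} → E a b ≤ x + D y b → E a b ≤ x + detour D u v c y b → E a b ≤ x + detour D v u c y b →
                E a b ≤ x + E y b
        split {x} p q r = ≤-+-⊓ x (D y b) _ p (≤-+-⊓ x (detour D u v c y b) (detour D v u c y b) q r)
        viaD = split (≤-trans (addEdge≤ D u v c a b) (triangle a y b))
                     (≤-trans (addEdge≤detour D u v c a b) (detour-triangleˡ u v c a y b))
                     (≤-trans (addEdge≤detour′ D u v c a b) (detour-triangleˡ v u c a y b))
        viaP = split (≤-trans (addEdge≤detour D u v c a b) (detour-triangleʳ u v c a y b))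
                     (≤-trans (addEdge≤detour D u v c a b) (detour-twice u v c a y b))
                     (≤-trans (addEdge≤ D u v c a b) (≤-detour-back u v c a y b))
        viaQ = split (≤-trans (addEdge≤detour′ D u v c a b) (detour-triangleʳ v u c a y b))
                     (≤-trans (addEdge≤ D u v c a b) (≤-detour-back v u c a y b))
                     (≤-trans (addEdge≤detour′ D u v c a b) (detour-twice v u c a y b))

  module _ {A : Set} (D : A → A → ℕ) (h : A → ℕ) where

    -- Shortest paths through a new point at distance h x from each x.
    apex : A → A → ℕ
    apex x y = D x y ⊓ (h x + h y)

  module _ {A : Set} {D : A → A → ℕ} {h : A → ℕ} (isMetric : IsℕMetric D) where
    open IsℕMetric isMetric

    apex-isMetric : (∀ x y → h x ≤ D x y + h y) → (∀ x → 0 < h x) → IsℕMetric (apex D h)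
    apex-isMetric h-lipschitz h-positive = record
      { symm     = λ x y → cong₂ _⊓_ (symm x y) (+-comm (h x) (h y))
      ; refl-0   = λ x → cong (_⊓ (h x + h x)) (refl-0 x)
      ; positive = λ {x} x≢y → ⊓-glb (positive x≢y) (≤-trans (h-positive x) (m≤m+n (h x) _))
      ; triangle = apex-triangle
      }
      where
      apex-triangle : ∀ x y z → apex D h x z ≤ apex D h x y + apex D h y z
      apex-triangle x y z = ≤-⊓-+ (D x y) (h x + h y) (apex D h y z)
        (≤-+-⊓ (D x y) (D y z) (h y + h z)
          (≤-trans (m⊓n≤m _ _) (triangle x y z))
          (≤-trans (m⊓n≤n _ _) (begin
            h x + h z         ≤⟨ +-monoˡ-≤ (h z) (h-lipschitz x y) ⟩
            D x y + h y + h z ≡⟨ +-assoc (D x y) (h y) (h z) ⟩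
            D x y + (h y + h z) ∎)))
        (≤-+-⊓ (h x + h y) (D y z) (h y + h z)
          (≤-trans (m⊓n≤n _ _) (begin
            h x + h z           ≤⟨ +-monoʳ-≤ (h x) (h-lipschitz z y) ⟩
            h x + (D z y + h y) ≡⟨ cong (λ t → h x + (t + h y)) (symm z y) ⟩
            h x + (D y z + h y) ≡⟨ swap-last (h x) (D y z) (h y) ⟩
            h x + h y + D y z   ∎))
          (≤-trans (m⊓n≤n _ _) (begin
            h x + h z             ≤⟨ +-monoˡ-≤ (h z) (m≤m+n (h x) (h y + h y)) ⟩
            h x + (h y + h y) + h z ≡⟨ regroup (h x) (h y) (h y) (h z) ⟩
            h x + h y + (h y + h z) ∎)))
        where
        open ≤-Reasoning
        swap-last : ∀ a b c → a + (b + c) ≡ a + c + b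
        swap-last = solve-∀
        regroup : ∀ a b c e → a + (b + c) + e ≡ a + b + (c + e)
        regroup = solve-∀

  module _ {n : ℕ} (D : Fin (suc n) → Fin (suc n) → ℕ) (w : Fin (suc n) → ℕ) where

    hub : Fin (suc n) → Fin (suc n)
    hub x = argminFin (λ z → D x z + w z)

    hubDistance : Fin (suc n) → ℕ
    hubDistance x = D x (hub x) + w (hub x)

    hubDistance-≤ : ∀ x z → hubDistance x ≤ D x z + w z
    hubDistance-≤ x = argminFin-≤ (λ z → D x z + w z)

    hubMetric : Fin (suc n) → Fin (suc n) → ℕ
    hubMetric = apex D hubDistance

  module _ {n : ℕ} {D : Fin (suc n) → Fin (suc n) → ℕ} (isMetric : IsℕMetric D) (w : Fin (suc n) → ℕ) where
    open IsℕMetric isMetric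

    hubDistance-lipschitz : ∀ x y → hubDistance D w x ≤ D x y + hubDistance D w y
    hubDistance-lipschitz x y = begin
      hubDistance D w x   ≤⟨ hubDistance-≤ D w x z ⟩
      D x z + w z         ≤⟨ +-monoˡ-≤ (w z) (triangle x y z) ⟩
      D x y + D y z + w z ≡⟨ +-assoc (D x y) (D y z) (w z) ⟩
      D x y + hubDistance D w y ∎
      where
      open ≤-Reasoning
      z = hub D w y

    hubDistance≤weight : ∀ x → hubDistance D w x ≤ w x
    hubDistance≤weight x = subst (λ t → hubDistance D w x ≤ t + w x) (refl-0 x) (hubDistance-≤ D w x x)

    hubMetric-isMetric : (∀ z → 0 < w z) → IsℕMetric (hubMetric D w)
    hubMetric-isMetric w-positive = apex-isMetric isMetric hubDistance-lipschitz
      (λ x → ≤-trans (w-positive (hub D w x)) (m≤n+m _ _))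

    hubMetric≤weights : ∀ x y → hubMetric D w x y ≤ w x + w y
    hubMetric≤weights x y = ≤-trans (m⊓n≤n _ _) (+-mono-≤ (hubDistance≤weight x) (hubDistance≤weight y))

    detour-weights : ∀ u v a b → detour D u v (w u + w v) a b ≡ (D a u + w u) + (D b v + w v)
    detour-weights u v a b = begin
      D a u + (w u + w v) + D v b ≡⟨ cong (D a u + (w u + w v) +_) (symm v b) ⟩
      D a u + (w u + w v) + D b v ≡⟨ regroup (D a u) (w u) (w v) (D b v) ⟩
      D a u + w u + (D b v + w v) ∎
      where
      open ≡-Reasoning
      regroup : ∀ x y z t → x + (y + z) + t ≡ x + y + (t + z)
      regroup = solve-∀

    addEdge-hubs≤ : ∀ x y → let u = hub D w x; v = hub D w y in
                    addEdge D u v (w u + w v) x y ≤ hubDistance D w x + hubDistance D w y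
    addEdge-hubs≤ x y = ≤-trans (addEdge≤detour D (hub D w x) (hub D w y) _ x y)
                                (≤-reflexive (detour-weights (hub D w x) (hub D w y) x y))

  module _ {n : ℕ} {D : Fin (suc n) → Fin (suc n) → ℕ} {w w′ : Fin (suc n) → ℕ}
           (w≤w′ : ∀ z → w z ≤ w′ z) where

    hubDistance-monoʷ : ∀ t → hubDistance D w t ≤ hubDistance D w′ t
    hubDistance-monoʷ t = ≤-trans (hubDistance-≤ D w t z) (+-monoʳ-≤ (D t z) (w≤w′ z))
      where z = hub D w′ t

    hubMetric-monoʷ : ∀ x y → hubMetric D w x y ≤ hubMetric D w′ x y
    hubMetric-monoʷ x y = ⊓-monoʳ-≤ (D x y) (+-mono-≤ (hubDistance-monoʷ x) (hubDistance-monoʷ y))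

    hubDistance-addEdge : ∀ u v c → w u ≤ c → w v ≤ c →
                          ∀ t → hubDistance D w t ≤ hubDistance (addEdge D u v c) w′ t
    hubDistance-addEdge u v c wu≤c wv≤c t = ≤-⊓-+ (D t z) _ (w′ z)
      (≤-trans (hubDistance-≤ D w t z) (+-monoʳ-≤ (D t z) (w≤w′ z)))
      (≤-⊓-+ (detour D u v c t z) (detour D v u c t z) (w′ z) (viaEdge u v wu≤c) (viaEdge v u wv≤c))
      where
      open ≤-Reasoning
      z = hub (addEdge D u v c) w′ t
      viaEdge : ∀ u v → w u ≤ c → hubDistance D w t ≤ detour D u v c t z + w′ z
      viaEdge u v wu≤c = begin
        hubDistance D w t              ≤⟨ hubDistance-≤ D w t u ⟩
        D t u + w u                    ≤⟨ +-monoʳ-≤ (D t u) wu≤c ⟩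
        D t u + c                      ≤⟨ m≤m+n (D t u + c) (D v z) ⟩
        D t u + c + D v z              ≤⟨ m≤m+n (D t u + c + D v z) (w′ z) ⟩
        detour D u v c t z + w′ z      ∎

    hubMetric-addEdge : IsℕMetric D → ∀ u v c → w u + w v ≤ c → ∀ a b →
                        hubMetric D w a b ≤ hubMetric (addEdge D u v c) w′ a b
    hubMetric-addEdge isMetric u v c w≤c a b = ⊓-glb
      (⊓-glb (m⊓n≤m _ _) (⊓-glb (cap≤detour u v w≤c) (cap≤detour v u (subst (_≤ c) (+-comm (w u) (w v)) w≤c))))
      (≤-trans (m⊓n≤n _ _) (+-mono-≤ (H≤H′ a) (H≤H′ b)))
      where
      open IsℕMetric isMetric
      open ≤-Reasoning
      wu≤c = ≤-trans (m≤m+n (w u) (w v)) w≤c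
      wv≤c = ≤-trans (m≤n+m (w v) (w u)) w≤c
      H≤H′ = hubDistance-addEdge u v c wu≤c wv≤c
      cap≤detour : ∀ u v → w u + w v ≤ c → hubMetric D w a b ≤ detour D u v c a b
      cap≤detour u v w≤c = begin
        hubMetric D w a b                       ≤⟨ m⊓n≤n _ _ ⟩
        hubDistance D w a + hubDistance D w b   ≤⟨ +-mono-≤ (hubDistance-≤ D w a u) (hubDistance-≤ D w b v) ⟩
        D a u + w u + (D b v + w v)             ≡⟨ detour-weights isMetric w u v a b ⟨
        detour D u v (w u + w v) a b            ≤⟨ +-monoˡ-≤ (D v b) (+-monoʳ-≤ (D a u) w≤c) ⟩
        detour D u v c a b                      ∎

  halve : ∀ k a r → 2 ^ suc k * a ≤ 2 ^ suc r → 2 ^ k * a ≤ 2 ^ r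
  halve k a r le = *-cancelˡ-≤ 2 (subst (_≤ 2 ^ suc r) (*-assoc 2 (2 ^ k) a) le)

  suc≤2^ : ∀ a r → 2 ^ 2 * a ≤ 2 ^ suc r → suc a ≤ 2 ^ r
  suc≤2^ zero    r _  = m^n>0 2 r
  suc≤2^ (suc a) r le = ≤-trans (subst (2 + a ≤_) (sym (*-suc 2 a)) (+-monoʳ-≤ 2 (m≤m+n a (a + 0))))
                                (halve 1 (suc a) r le)

  Edge : ℕ → Set
  Edge n = Fin n × ℕ

  Graph : ℕ → Set
  Graph n = Fin n → List (Edge n)

  data Sparse {n : ℕ} : ℕ → List (Edge n) → Set where
    []  : ∀ {k} → Sparse k []
    _∷_ : ∀ {k v c es} → k ≤ c → Sparse (suc k) es → Sparse k ((v , c) ∷ es)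

  Sparse-++ : ∀ {n k} {es es′ : List (Edge n)} → Sparse k es → Sparse (k + length es) es′ → Sparse k (es ++ es′)
  Sparse-++ {k = k} {es′ = es′} []                      s′ = subst (λ j → Sparse j es′) (+-identityʳ k) s′
  Sparse-++ {k = k} {es′ = es′} (_∷_ {es = es} k≤c s) s′ =
    k≤c ∷ Sparse-++ s (subst (λ j → Sparse j es′) (+-suc k (length es)) s′)

  data Walk {n : ℕ} (G : Graph n) : ℕ → Fin n → Fin n → Set where
    []   : ∀ {r x} → Walk G r x x
    step : ∀ {r s x v c y} → (v , c) ∈ G x → 0 < c → c + r ≤ s → Walk G r v y → Walk G s x y

  module _ {n : ℕ} {G : Graph n} where

    Walk-mono : ∀ {r s x y} → r ≤ s → Walk G r x y → Walk G s x y
    Walk-mono r≤s []                   = []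
    Walk-mono r≤s (step e 0<c c+r≤s w) = step e 0<c (≤-trans c+r≤s r≤s) w

    Walk-++ : ∀ {r s x y z} → Walk G r x y → Walk G s y z → Walk G (r + s) x z
    Walk-++ {r} {s} []                      w′ = Walk-mono (m≤n+m s r) w′
    Walk-++ {r} {s} (step {r = r′} {c = c} e 0<c c+r′≤r w) w′ =
      step e 0<c (subst (_≤ r + s) (+-assoc c r′ s) (+-monoˡ-≤ s c+r′≤r)) (Walk-++ w w′)

    Walk-⊆ : ∀ {G′ : Graph n} → (∀ z {e} → e ∈ G z → e ∈ G′ z) →
             ∀ {r x y} → Walk G r x y → Walk G′ r x y
    Walk-⊆ G⊆G′ []                           = []
    Walk-⊆ G⊆G′ (step {x = x} e 0<c c+r≤s w) = step (G⊆G′ x e) 0<c c+r≤s (Walk-⊆ G⊆G′ w)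

  module _ {n : ℕ} (G : Graph n) where

    -- ball f r x lists the ends of the walks from x of length at most r with
    -- fewer than f edges; f > r suffices since edge lengths are positive.
    mutual
      ball : ℕ → ℕ → Fin n → List (Fin n)
      ball zero     r x = []
      ball (suc f) r x = x ∷ ballAlong f r (G x)

      ballAlong : ℕ → ℕ → List (Edge n) → List (Fin n)
      ballAlong f r []             = []
      ballAlong f r ((v , c) ∷ es) with c ≤? r
      ... | yes _ = ball f (r ∸ c) v ++ ballAlong f r es
      ... | no  _ = ballAlong f r es

    ∈-ballAlong : ∀ {f r v c y} es → (v , c) ∈ es → c ≤ r → y ∈ ball f (r ∸ c) v → y ∈ ballAlong f r es
    ∈-ballAlong {r = r} ((v , c) ∷ es) (here refl) c≤r y∈ball with c ≤? r
    ... | yes _   = ∈-++⁺ˡ y∈ball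
    ... | no  c≰r = ⊥-elim (c≰r c≤r)
    ∈-ballAlong {f} {r} ((v′ , c′) ∷ es) (there e) c≤r y∈ball with c′ ≤? r
    ... | yes _ = ∈-++⁺ʳ (ball f (r ∸ c′) v′) (∈-ballAlong es e c≤r y∈ball)
    ... | no  _ = ∈-ballAlong es e c≤r y∈ball

    Walk⇒∈ball : ∀ f {r x y} → r < f → Walk G r x y → y ∈ ball f r x
    Walk⇒∈ball (suc f) r<f []                                       = here refl
    Walk⇒∈ball (suc f) {r} {x} r<f (step {r = r′} {c = c} e 0<c c+r′≤r w) =
      there (∈-ballAlong (G x) e c≤r (Walk⇒∈ball f r∸c<f (Walk-mono r′≤r∸c w)))
      where
      c≤r : c ≤ r
      c≤r = ≤-trans (m≤m+n c r′) c+r′≤r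
      r′≤r∸c : r′ ≤ r ∸ c
      r′≤r∸c = subst (_≤ r ∸ c) (m+n∸m≡n c r′) (∸-monoˡ-≤ c c+r′≤r)
      r∸c<f : r ∸ c < f
      r∸c<f = ≤-trans (∸-monoʳ-< 0<c c≤r) (≤-pred r<f)

    ballAlong-length : ∀ f → (∀ r x → length (ball f r x) ≤ 2 ^ r) →
                       ∀ {k es} r → Sparse k es → 2 ^ k * length (ballAlong f r es) ≤ 2 ^ suc r
    ballAlong-length f ball-bound {k} r [] = ≤-trans (≤-reflexive (*-zeroʳ (2 ^ k))) z≤n
    ballAlong-length f ball-bound {k} r (_∷_ {v = v} {c} {es} k≤c sparse) with c ≤? r
    ... | no _    = ≤-trans tail-bound (^-monoʳ-≤ 2 (n≤1+n r))
      where tail-bound = halve k (length (ballAlong f r es)) r (ballAlong-length f ball-bound r sparse)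
    ... | yes c≤r = begin
      2 ^ k * (length (ball f (r ∸ c) v ++ rest))             ≡⟨ cong (2 ^ k *_) (length-++ (ball f (r ∸ c) v)) ⟩
      2 ^ k * (length (ball f (r ∸ c) v) + length rest)       ≡⟨ *-distribˡ-+ (2 ^ k) _ _ ⟩
      2 ^ k * length (ball f (r ∸ c) v) + 2 ^ k * length rest ≤⟨ +-mono-≤ head-bound rest-bound ⟩
      2 ^ r + 2 ^ r                                           ≡⟨ cong (2 ^ r +_) (+-identityʳ (2 ^ r)) ⟨
      2 ^ suc r                                               ∎
      where
      open ≤-Reasoning
      rest = ballAlong f r es
      rest-bound : 2 ^ k * length rest ≤ 2 ^ r
      rest-bound = halve k (length rest) r (ballAlong-length f ball-bound r sparse)
      head-bound : 2 ^ k * length (ball f (r ∸ c) v) ≤ 2 ^ r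
      head-bound = begin
        2 ^ k * length (ball f (r ∸ c) v) ≤⟨ *-mono-≤ (^-monoʳ-≤ 2 k≤c) (ball-bound (r ∸ c) v) ⟩
        2 ^ c * 2 ^ (r ∸ c)               ≡⟨ ^-distribˡ-+-* 2 c (r ∸ c) ⟨
        2 ^ (c + (r ∸ c))                 ≡⟨ cong (2 ^_) (m+[n∸m]≡n c≤r) ⟩
        2 ^ r                             ∎

    ball-length : (∀ z → Sparse 2 (G z)) → ∀ f r x → length (ball f r x) ≤ 2 ^ r
    ball-length sparse zero    r x = z≤n
    ball-length sparse (suc f) r x =
      suc≤2^ (length (ballAlong f r (G x))) r (ballAlong-length f (ball-length sparse f) r (sparse x))

  module _ {n : ℕ} (u v : Fin n) (c : ℕ) where

    entryIf : Bool → Edge n → List (Edge n)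
    entryIf b e = if b then [ e ] else []

    newEntries : Fin n → List (Edge n)
    newEntries z = entryIf (does (z Fin.≟ u)) (v , c) ++ entryIf (does (z Fin.≟ v)) (u , c)

    insertEdge : Graph n → Graph n
    insertEdge G z = G z ++ newEntries z

    length-entryIf : ∀ b e → length (entryIf b e) ≡ indicator b
    length-entryIf true  e = refl
    length-entryIf false e = refl

    length-newEntries : ∀ z → length (newEntries z) ≡ indicator (does (z Fin.≟ u)) + indicator (does (z Fin.≟ v))
    length-newEntries z = trans (length-++ (entryIf (does (z Fin.≟ u)) (v , c)))
      (cong₂ _+_ (length-entryIf (does (z Fin.≟ u)) (v , c)) (length-entryIf (does (z Fin.≟ v)) (u , c)))

    ∑-length-newEntries : ∑[ z < n ] length (newEntries z) ≡ 2
    ∑-length-newEntries = begin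
      ∑[ z < n ] length (newEntries z)
        ≡⟨ sum-cong-≗ length-newEntries ⟩
      ∑[ z < n ] (indicator (does (z Fin.≟ u)) + indicator (does (z Fin.≟ v)))
        ≡⟨ ∑-distrib-+ (indicator ∘ does ∘ (Fin._≟ u)) (indicator ∘ does ∘ (Fin._≟ v)) ⟩
      ∑[ z < n ] indicator (does (z Fin.≟ u)) + ∑[ z < n ] indicator (does (z Fin.≟ v))
        ≡⟨ cong₂ _+_ (∑-indicator-≟ u) (∑-indicator-≟ v) ⟩
      2 ∎
      where open ≡-Reasoning

    ∑-length-insertEdge : ∀ G → ∑[ z < n ] length (insertEdge G z) ≡ ∑[ z < n ] length (G z) + 2
    ∑-length-insertEdge G = begin
      ∑[ z < n ] length (G z ++ newEntries z)                    ≡⟨ sum-cong-≗ (λ z → length-++ (G z)) ⟩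
      ∑[ z < n ] (length (G z) + length (newEntries z))          ≡⟨ ∑-distrib-+ (length ∘ G) (length ∘ newEntries) ⟩
      ∑[ z < n ] length (G z) + ∑[ z < n ] length (newEntries z) ≡⟨ cong (_ +_) ∑-length-newEntries ⟩
      ∑[ z < n ] length (G z) + 2                                ∎
      where open ≡-Reasoning

    Sparse-newEntries : ∀ {j} z → (z ≡ u → j ≤ c) → (z ≡ v → j ≤ c) → (z ≡ u → z ≡ v → suc j ≤ c) →
                        Sparse j (newEntries z)
    Sparse-newEntries z ≤c₁ ≤c₂ <c with z Fin.≟ u | z Fin.≟ v
    ... | yes z≡u | yes z≡v = ≤c₁ z≡u ∷ <c z≡u z≡v ∷ []
    ... | yes z≡u | no  _   = ≤c₁ z≡u ∷ []
    ... | no  _   | yes z≡v = ≤c₂ z≡v ∷ []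
    ... | no  _   | no  _   = []

    module _ {G : Graph n} where

      Walk-insertEdge : ∀ {r x y} → Walk G r x y → Walk (insertEdge G) r x y
      Walk-insertEdge = Walk-⊆ (λ z → ∈-++⁺ˡ)

      Walk-newEdge : 0 < c → Walk (insertEdge G) c u v
      Walk-newEdge 0<c = step (∈-++⁺ʳ (G u) new∈) 0<c (≤-reflexive (+-identityʳ c)) []
        where
        new∈ : (v , c) ∈ newEntries u
        new∈ with u Fin.≟ u
        ... | yes _   = here refl
        ... | no  u≢u = ⊥-elim (u≢u refl)

      Walk-newEdge′ : 0 < c → Walk (insertEdge G) c v u
      Walk-newEdge′ 0<c = step (∈-++⁺ʳ (G v) new∈) 0<c (≤-reflexive (+-identityʳ c)) []
        where
        new∈ : (u , c) ∈ newEntries v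
        new∈ with v Fin.≟ u | v Fin.≟ v
        ... | _      | no v≢v = ⊥-elim (v≢v refl)
        ... | yes _  | yes _  = there (here refl)
        ... | no  _  | yes _  = here refl

  module Adversary (m K : ℕ) where

    V : Set
    V = Fin (suc m)

    record State : Set where
      field
        graph : Graph (suc m)
        dist  : V → V → ℕ
    open State public

    weight : State → V → ℕ
    weight s z = 2 + length (graph s z)

    answer : State → V → V → ℕ
    answer s = hubMetric (dist s) (weight s)

    hubOf : State → V → V
    hubOf s = hub (dist s) (weight s)

    edgeLength : State → V → V → ℕ
    edgeLength s x y = weight s (hubOf s x) + weight s (hubOf s y)

    after : State → V → V → State
    after s x y = record
      { graph = insertEdge (hubOf s x) (hubOf s y) (edgeLength s x y) (graph s)
      ; dist  = addEdge (dist s) (hubOf s x) (hubOf s y) (edgeLength s x y)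
      }

    record Invariant (s : State) : Set where
      field
        isMetric : IsℕMetric (dist s)
        sparse   : ∀ z → Sparse 2 (graph s z)
        walk     : ∀ x y → dist s x y < K → Walk (graph s) (dist s x y) x y
    open Invariant

    weight-after : ∀ s x y z → weight s z ≤ weight (after s x y) z
    weight-after s x y z = +-monoʳ-≤ 2 (≤-trans (m≤m+n _ _) (≤-reflexive (sym (length-++ (graph s z)))))

    after-sparse : ∀ {s} → (∀ z → Sparse 2 (graph s z)) → ∀ x y z → Sparse 2 (graph (after s x y) z)
    after-sparse {s} sparse x y z = Sparse-++ (sparse z) (Sparse-newEntries u v c z
      (λ z≡u → subst (λ t → weight s t ≤ c) (sym z≡u) (m≤m+n (weight s u) (weight s v)))
      (λ z≡v → subst (λ t → weight s t ≤ c) (sym z≡v) (m≤n+m (weight s v) (weight s u)))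
      (λ z≡u z≡v → subst₂ (λ t t′ → suc (weight s z) ≤ weight s t + weight s t′) z≡u z≡v
                     (m<m+n (weight s z) (s≤s z≤n))))
      where
      u = hubOf s x
      v = hubOf s y
      c = edgeLength s x y

    after-walk : ∀ {s} → Invariant s → ∀ x y a b → dist (after s x y) a b < K →
                 Walk (graph (after s x y)) (dist (after s x y) a b) a b
    after-walk {s} inv x y a b = ⊓-preserves Reachable (D a b) _
      (λ lt → Walk-insertEdge u v c (walk inv a b lt))
      (⊓-preserves Reachable (detour D u v c a b) (detour D v u c a b)
        (viaNewEdge u v (Walk-newEdge u v c {G = graph s} 0<c))
        (viaNewEdge v u (Walk-newEdge′ u v c {G = graph s} 0<c)))
      where
      D  = dist s
      u  = hubOf s x
      v  = hubOf s y
      c  = edgeLength s x y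
      G′ = graph (after s x y)
      0<c : 0 < c
      0<c = s≤s z≤n
      Reachable : ℕ → Set
      Reachable t = t < K → Walk G′ t a b
      viaNewEdge : ∀ p q → Walk G′ c p q → Reachable (detour D p q c a b)
      viaNewEdge p q edge lt =
        Walk-++ (Walk-++ (Walk-insertEdge u v c (walk inv a p (≤-<-trans (≤-trans (m≤m+n _ c) (m≤m+n _ _)) lt))) edge)
                (Walk-insertEdge u v c (walk inv q b (≤-<-trans (m≤n+m _ _) lt)))

    after-invariant : ∀ {s} → Invariant s → ∀ x y → Invariant (after s x y)
    after-invariant {s} inv x y = record
      { isMetric = addEdge-isMetric (isMetric inv) (hubOf s x) (hubOf s y) (edgeLength s x y) (s≤s z≤n)
      ; sparse   = after-sparse (sparse inv) x y
      ; walk     = after-walk inv x y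
      }

    initial : State
    initial = record { graph = λ _ → [] ; dist = discrete K }

    initial-invariant : 0 < K → Invariant initial
    initial-invariant 0<K = record
      { isMetric = discrete-isMetric K 0<K
      ; sparse   = λ _ → []
      ; walk     = initial-walk
      }
      where
      initial-walk : ∀ x y → discrete K x y < K → Walk (graph initial) (discrete K x y) x y
      initial-walk x y lt with x Fin.≟ y
      ... | yes refl = []
      ... | no  _    = ⊥-elim (<-irrefl refl lt)

    answer≤hubMetric-after : ∀ {s} → Invariant s → ∀ x y w → (∀ z → weight (after s x y) z ≤ w z) →
                   ∀ a b → answer s a b ≤ hubMetric (dist (after s x y)) w a b
    answer≤hubMetric-after {s} inv x y w w-bound =
      hubMetric-addEdge {D = dist s} {w = weight s} {w′ = w} (λ z → ≤-trans (weight-after s x y z) (w-bound z))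
        (isMetric inv) (hubOf s x) (hubOf s y) (edgeLength s x y) ≤-refl

    dist-after≤answer : ∀ {s} → Invariant s → ∀ x y → dist (after s x y) x y ≤ answer s x y
    dist-after≤answer {s} inv x y = ⊓-glb (addEdge≤ (dist s) _ _ _ x y) (addEdge-hubs≤ (isMetric inv) (weight s) x y)

    play : QueryAlg (suc m) → State → State
    play (output p)    s = s
    play (query x y k) s = play (k (toℚ (answer s x y))) (after s x y)

    outcome : QueryAlg (suc m) → State → V
    outcome (output p)    s = p
    outcome (query x y k) s = outcome (k (toℚ (answer s x y))) (after s x y)

    rounds : QueryAlg (suc m) → State → ℕ
    rounds (output p)    s = 0
    rounds (query x y k) s = suc (rounds (k (toℚ (answer s x y))) (after s x y))

    play-invariant : ∀ alg {s} → Invariant s → Invariant (play alg s)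
    play-invariant (output p)    inv = inv
    play-invariant (query x y k) inv = play-invariant (k _) (after-invariant inv x y)

    dist-play : ∀ alg s a b → dist (play alg s) a b ≤ dist s a b
    dist-play (output p)    s a b = ≤-refl
    dist-play (query x y k) s a b = ≤-trans (dist-play (k _) (after s x y) a b) (addEdge≤ (dist s) _ _ _ a b)

    answer≤hubMetric-play : ∀ alg {s} → Invariant s → ∀ w → (∀ z → weight (play alg s) z ≤ w z) →
                  ∀ a b → answer s a b ≤ hubMetric (dist (play alg s)) w a b
    answer≤hubMetric-play (output p)    {s} inv w w-bound = hubMetric-monoʷ w-bound
    answer≤hubMetric-play (query x y k) {s} inv w w-bound a b =
      ≤-trans (answer≤hubMetric-after inv x y (weight (after s x y)) (λ _ → ≤-refl) a b)
              (answer≤hubMetric-play (k _) (after-invariant inv x y) w w-bound a b)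

    module _ (w : V → ℕ) where

      finalMetric : QueryAlg (suc m) → State → V → V → ℚ
      finalMetric alg s a b = toℚ (hubMetric (dist (play alg s)) w a b)

      play-consistent : ∀ alg {s} → Invariant s → (∀ z → weight (play alg s) z ≤ w z) →
                        run alg (finalMetric alg s) ≡ outcome alg s × queries alg (finalMetric alg s) ≡ rounds alg s
      play-consistent (output p)    inv w-bound = refl , refl
      play-consistent (query x y k) {s} inv w-bound =
        trans (cong (λ t → run (k t) d) answered) (proj₁ rest) ,
        cong suc (trans (cong (λ t → queries (k t) d) answered) (proj₂ rest))
        where
        alg′ = k (toℚ (answer s x y))
        d    = finalMetric alg′ (after s x y)
        rest = play-consistent (k (toℚ (answer s x y))) (after-invariant inv x y) w-bound
        answered : d x y ≡ toℚ (answer s x y)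
        answered = cong toℚ (≤-antisym
          (≤-trans (m⊓n≤m _ _) (≤-trans (dist-play alg′ (after s x y) x y) (dist-after≤answer inv x y)))
          (≤-trans (answer≤hubMetric-after inv x y (weight (after s x y)) (λ _ → ≤-refl) x y)
                   (answer≤hubMetric-play alg′ (after-invariant inv x y) w w-bound x y)))

    degreeSum : State → ℕ
    degreeSum s = ∑[ z < suc m ] length (graph s z)

    degreeSum-play : ∀ alg s → degreeSum (play alg s) ≡ degreeSum s + 2 * rounds alg s
    degreeSum-play (output p)    s = sym (+-identityʳ (degreeSum s))
    degreeSum-play (query x y k) s = begin
      degreeSum (play alg′ s′)                ≡⟨ degreeSum-play (k (toℚ (answer s x y))) s′ ⟩
      degreeSum s′ + 2 * rounds alg′ s′       ≡⟨ cong (_+ 2 * rounds alg′ s′) (∑-length-insertEdge u v c (graph s)) ⟩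
      degreeSum s + 2 + 2 * rounds alg′ s′    ≡⟨ +-assoc (degreeSum s) 2 _ ⟩
      degreeSum s + (2 + 2 * rounds alg′ s′)  ≡⟨ cong (degreeSum s +_) (*-suc 2 (rounds alg′ s′)) ⟨
      degreeSum s + 2 * suc (rounds alg′ s′)  ∎
      where
      open ≡-Reasoning
      alg′ = k (toℚ (answer s x y))
      s′   = after s x y
      u    = hubOf s x
      v    = hubOf s y
      c    = edgeLength s x y

  module Analysis (m K : ℕ) (0<K : 0 < K) (alg : QueryAlg (suc m)) where
    open Adversary m K
    open DecMembership (Fin._≟_ {suc m}) using (_∈?_)

    final : State
    final = play alg initial

    p : V
    p = outcome alg initial

    deficit : V → ℕ
    deficit z = K ∸ dist final p z

    w : V → ℕ
    w z = weight final z + deficit z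

    d : V → V → ℕ
    d = hubMetric (dist final) w

    final-invariant : Invariant final
    final-invariant = play-invariant alg (initial-invariant 0<K)
    open Invariant final-invariant

    d-isMetric : IsℕMetric d
    d-isMetric = hubMetric-isMetric (isMetric) w (λ _ → s≤s z≤n)

    d-consistent : run alg (λ a b → toℚ (d a b)) ≡ p × queries alg (λ a b → toℚ (d a b)) ≡ rounds alg initial
    d-consistent = play-consistent w alg (initial-invariant 0<K) (λ z → m≤m+n (weight final z) (deficit z))

    B : List V
    B = ball (graph final) (suc K) K p

    K≤dist-outside-ball : ∀ y → ¬ (y ∈ B) → K ≤ dist final p y
    K≤dist-outside-ball y y∉B with dist final p y <? K
    ... | yes lt = ⊥-elim (y∉B (Walk⇒∈ball (graph final) (suc K) (n<1+n K)
                                  (Walk-mono (<⇒≤ lt) (walk p y lt))))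
    ... | no  ≮ = ≮⇒≥ ≮

    deficit≤ : ∀ y → deficit y ≤ K * indicator (does (y ∈? B))
    deficit≤ y = bound (y ∈? B)
      where
      bound : (y∈?B : Dec (y ∈ B)) → deficit y ≤ K * indicator (does y∈?B)
      bound (yes _)   = subst (deficit y ≤_) (sym (*-identityʳ K)) (m∸n≤m K (dist final p y))
      bound (no  y∉B) = subst₂ _≤_ (sym (m≤n⇒m∸n≡0 (K≤dist-outside-ball y y∉B))) (sym (*-zeroʳ K)) z≤n

    ∑-deficit : ∑[ y < suc m ] deficit y ≤ K * 2 ^ K
    ∑-deficit = begin
      ∑[ y < suc m ] deficit y                               ≤⟨ ∑-mono-≤ deficit≤ ⟩
      ∑[ y < suc m ] (K * indicator (does (y ∈? B)))         ≡⟨ *-distribˡ-sum K (indicator ∘ does ∘ (_∈? B)) ⟨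
      K * ∑[ y < suc m ] indicator (does (y ∈? B))           ≤⟨ *-monoʳ-≤ K (∑-indicator-∈ B) ⟩
      K * length B                                           ≤⟨ *-monoʳ-≤ K (ball-length (graph final) sparse (suc K) K p) ⟩
      K * 2 ^ K                                              ∎
      where open ≤-Reasoning

    K≤hubDistance-p : K ≤ hubDistance (dist final) w p
    K≤hubDistance-p = begin
      K                                ≤⟨ m≤n+m∸n K (dist final p z) ⟩
      dist final p z + deficit z       ≤⟨ +-monoʳ-≤ (dist final p z) (m≤n+m (deficit z) (weight final z)) ⟩
      hubDistance (dist final) w p     ∎
      where
      open ≤-Reasoning
      z = hub (dist final) w p

    K≤d+deficit : ∀ y → K ≤ d p y + deficit y
    K≤d+deficit y = begin
      K
        ≤⟨ ⊓-preserves (λ t → K ≤ t + deficit y) (dist final p y) K (m≤n+m∸n K (dist final p y)) (m≤m+n K _) ⟩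
      dist final p y ⊓ K + deficit y
        ≤⟨ +-monoˡ-≤ (deficit y) (⊓-monoʳ-≤ (dist final p y) (≤-trans K≤hubDistance-p (m≤m+n _ _))) ⟩
      d p y + deficit y ∎
      where open ≤-Reasoning

    cost-output : suc m * K ≤ ∑[ y < suc m ] d p y + ∑[ y < suc m ] deficit y
    cost-output = begin
      suc m * K                                          ≡⟨ ∑-const (suc m) K ⟨
      ∑[ y < suc m ] K                                   ≤⟨ ∑-mono-≤ K≤d+deficit ⟩
      ∑[ y < suc m ] (d p y + deficit y)                 ≡⟨ ∑-distrib-+ (d p) deficit ⟩
      ∑[ y < suc m ] d p y + ∑[ y < suc m ] deficit y    ∎
      where open ≤-Reasoning

    q : V
    q = argminFin w

    ∑-weight : ∑[ z < suc m ] weight final z ≡ suc m * 2 + 2 * rounds alg initial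
    ∑-weight = begin
      ∑[ z < suc m ] (2 + length (graph final z))               ≡⟨ ∑-distrib-+ (λ _ → 2) (length ∘ graph final) ⟩
      ∑[ z < suc m ] 2 + degreeSum final                        ≡⟨ cong₂ _+_ (∑-const (suc m) 2) (degreeSum-play alg initial) ⟩
      suc m * 2 + (degreeSum initial + 2 * rounds alg initial)  ≡⟨ cong (λ e → suc m * 2 + (e + 2 * rounds alg initial)) no-edges ⟩
      suc m * 2 + 2 * rounds alg initial                        ∎
      where
      open ≡-Reasoning
      no-edges : degreeSum initial ≡ 0
      no-edges = trans (∑-const (suc m) 0) (*-zeroʳ m)

    cost-median : ∑[ y < suc m ] d q y ≤ 2 * (suc m * 2 + 2 * rounds alg initial + ∑[ y < suc m ] deficit y)
    cost-median = begin
      ∑[ y < suc m ] d q y                 ≤⟨ ∑-mono-≤ d-q≤ ⟩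
      ∑[ y < suc m ] (2 * w y)             ≡⟨ *-distribˡ-sum 2 w ⟨
      2 * ∑[ y < suc m ] w y               ≡⟨ cong (2 *_) (trans (∑-distrib-+ (weight final) deficit) (cong (_+ sum deficit) ∑-weight)) ⟩
      2 * (suc m * 2 + 2 * rounds alg initial + ∑[ y < suc m ] deficit y) ∎
      where
      open ≤-Reasoning
      d-q≤ : ∀ y → d q y ≤ 2 * w y
      d-q≤ y = begin
        d q y         ≤⟨ hubMetric≤weights (isMetric) w q y ⟩
        w q + w y     ≤⟨ +-monoˡ-≤ (w y) (argminFin-≤ w y) ⟩
        w y + w y     ≡⟨ cong (w y +_) (+-identityʳ (w y)) ⟨
        2 * w y       ∎

  n<2^n : ∀ n → n < 2 ^ n
  n<2^n zero    = s≤s z≤n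
  n<2^n (suc n) = subst (2 + n ≤_) (cong (2 ^ n +_) (sym (+-identityʳ (2 ^ n)))) (+-mono-≤ (m^n>0 2 n) (n<2^n n))

  K*2^K≤2^[K+K] : ∀ K → K * 2 ^ K ≤ 2 ^ (K + K)
  K*2^K≤2^[K+K] K = subst (K * 2 ^ K ≤_) (sym (^-distribˡ-+-* 2 K K)) (*-monoˡ-≤ (2 ^ K) (<⇒≤ (n<2^n K)))

  power-of-4-bracket : ∀ n → 0 < n → ∃[ K ] 2 ^ (K + K) ≤ n × n < 2 ^ (suc K + suc K)
  power-of-4-bracket n 0<n = search n (<-≤-trans (n<2^n n) (^-monoʳ-≤ 2 (m≤m+n n n)))
    where
    search : ∀ j → n < 2 ^ (j + j) → ∃[ K ] 2 ^ (K + K) ≤ n × n < 2 ^ (suc K + suc K)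
    search zero    n<1 = ⊥-elim (<⇒≱ 0<n (≤-pred n<1))
    search (suc j) n<4^[1+j] with 2 ^ (j + j) ≤? n
    ... | yes 4^j≤n = j , 4^j≤n , n<4^[1+j]
    ... | no  4^j≰n = search j (≰⇒> 4^j≰n)

  n<2^k⇒⌈log₂n⌉≤k : ∀ {n} k → n < 2 ^ k → ⌈log₂ n ⌉ ≤ k
  n<2^k⇒⌈log₂n⌉≤k {n} k n<2^k = subst (⌈log₂ n ⌉ ≤_) (⌈log₂2^n⌉≡n k) (⌈log₂⌉-mono-≤ (<⇒≤ n<2^k))

  3≤K : ∀ {n} K → 64 ≤ n → n < 2 ^ (suc K + suc K) → 3 ≤ K
  3≤K K 64≤n n<4^[1+K] with 3 ≤? K
  ... | yes 3≤K = 3≤K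
  ... | no  3≰K = ⊥-elim (<⇒≱ n<4^[1+K] (≤-trans (^-monoʳ-≤ 2 (+-mono-≤ (s≤s K≤2) (s≤s K≤2))) 64≤n))
    where K≤2 = ≤-pred (≰⇒> 3≰K)

  -- For K ≥ 3: L ≤ 2 K + 2 ≤ 4 (K - 1) and cp ≥ n (K - 1), so L cq ≤ 4 (6 + 4 c) cp.
  cost-ratio : ∀ {n K c cp cq L} → 0 < n → 3 ≤ K → n * K ≤ cp + n → cq ≤ (6 + 4 * c) * n →
               L ≤ suc K + suc K → L * cq < suc (24 + 16 * c) * cp
  cost-ratio {n} {suc K} {c} {cp} {cq} {L} 0<n (s≤s 2≤K) cost-p cost-q L≤ = ≤-<-trans L*cq≤ (m<n+m _ 0<cp)
    where
    open ≤-Reasoning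
    expand : ∀ K → 2 + K + (2 + K) ≡ (2 + 2) + (K + K)
    expand = solve-∀
    quadruple : ∀ K → (K + K) + (K + K) ≡ 4 * K
    quadruple = solve-∀
    regroup : ∀ K c n → 4 * K * ((6 + 4 * c) * n) ≡ (24 + 16 * c) * (n * K)
    regroup = solve-∀
    nK≤cp : n * K ≤ cp
    nK≤cp = +-cancelˡ-≤ n (n * K) cp (subst₂ _≤_ (*-suc n K) (+-comm cp n) cost-p)
    L≤4K : L ≤ 4 * K
    L≤4K = begin
      L                               ≤⟨ L≤ ⟩
      2 + K + (2 + K)                 ≡⟨ expand K ⟩
      (2 + 2) + (K + K)               ≤⟨ +-monoˡ-≤ (K + K) (+-mono-≤ 2≤K 2≤K) ⟩
      (K + K) + (K + K)               ≡⟨ quadruple K ⟩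
      4 * K                           ∎
    L*cq≤ : L * cq ≤ (24 + 16 * c) * cp
    L*cq≤ = begin
      L * cq                          ≤⟨ *-mono-≤ L≤4K cost-q ⟩
      4 * K * ((6 + 4 * c) * n)       ≡⟨ regroup K c n ⟩
      (24 + 16 * c) * (n * K)         ≤⟨ *-monoʳ-≤ (24 + 16 * c) nK≤cp ⟩
      (24 + 16 * c) * cp              ∎
    0<cp : 0 < cp
    0<cp = ≤-trans (*-mono-≤ 0<n (≤-trans (s≤s z≤n) 2≤K)) nK≤cp

  1/1+ : ℕ → ℚ
  1/1+ D = 1/ toℚ (suc D)

  1/1+-positive : ∀ D → 0ℚ ℚ.< 1/1+ D
  1/1+-positive D = ℚ.positive⁻¹ (1/1+ D) {{ℚ.1/pos⇒pos (toℚ (suc D))}}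

  1/1+-scaled-< : ∀ D L q p (o : ℚ) → o ℚ.≤ toℚ q → L * q < suc D * p →
                  1/1+ D ℚ.* toℚ L ℚ.* o ℚ.< toℚ p
  1/1+-scaled-< D L q p o o≤q Lq<p = ℚ.≤-<-trans scale-o (ℚ.*-cancelˡ-<-nonNeg (toℚ (suc D)) unscaled)
    where
    instance
      1/1+-nonNeg : ℚ.NonNegative (1/1+ D)
      1/1+-nonNeg = ℚ.pos⇒nonNeg (1/1+ D) {{ℚ.1/pos⇒pos (toℚ (suc D))}}
    scale-o : 1/1+ D ℚ.* toℚ L ℚ.* o ℚ.≤ 1/1+ D ℚ.* toℚ (L * q)
    scale-o = subst (1/1+ D ℚ.* toℚ L ℚ.* o ℚ.≤_)
                    (trans (ℚ.*-assoc (1/1+ D) (toℚ L) (toℚ q)) (cong (1/1+ D ℚ.*_) (sym (toℚ-* L q))))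
                    (ℚ.*-monoˡ-≤-nonNeg (1/1+ D ℚ.* toℚ L) {{ℚ.nonNeg*nonNeg⇒nonNeg (1/1+ D) (toℚ L)}} o≤q)
    cancel : ∀ x → toℚ (suc D) ℚ.* (1/1+ D ℚ.* x) ≡ x
    cancel x = begin
      toℚ (suc D) ℚ.* (1/1+ D ℚ.* x) ≡⟨ ℚ.*-assoc (toℚ (suc D)) (1/1+ D) x ⟨
      toℚ (suc D) ℚ.* 1/1+ D ℚ.* x   ≡⟨ cong (ℚ._* x) (ℚ.*-inverseʳ (toℚ (suc D))) ⟩
      1ℚ ℚ.* x                    ≡⟨ ℚ.*-identityˡ x ⟩
      x                           ∎
      where open ≡-Reasoning
    unscaled : toℚ (suc D) ℚ.* (1/1+ D ℚ.* toℚ (L * q)) ℚ.< toℚ (suc D) ℚ.* toℚ p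
    unscaled = subst₂ ℚ._<_ (sym (cancel (toℚ (L * q)))) (toℚ-* (suc D) p) (toℚ-mono-< Lq<p)

  δ : ℕ → ℚ
  δ c = 1/1+ (24 + 16 * c)

  δ-positive : ∀ c → 0ℚ ℚ.< δ c
  δ-positive c = 1/1+-positive (24 + 16 * c)

  adversary-wins : ∀ m c (alg : QueryAlg (suc m)) → 64 ≤ suc m →
                   (∀ d → IsMetric d → queries alg d ≤ c * suc m) →
                   ∃[ d ] IsMetric d × δ c ℚ.* logℚ (suc m) ℚ.* opt d ℚ.< cost d (run alg d)
  adversary-wins m c alg 64≤n linear with power-of-4-bracket (suc m) (s≤s z≤n)
  ... | K , 4^K≤n , n<4^[1+K] = dℚ , dℚ-isMetric , ratio
    where
    K≥3 = 3≤K K 64≤n n<4^[1+K]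
    collect : ∀ n c → 2 * (n * 2 + 2 * (c * n) + n) ≡ (6 + 4 * c) * n
    collect = solve-∀
    open Adversary m K using (rounds; initial)
    open Analysis m K (≤-trans (s≤s z≤n) K≥3) alg
    dℚ : Fin (suc m) → Fin (suc m) → ℚ
    dℚ a b = toℚ (d a b)
    dℚ-isMetric = toℚ-isMetric d-isMetric
    few-rounds : rounds alg initial ≤ c * suc m
    few-rounds = subst (_≤ c * suc m) (proj₂ d-consistent) (linear dℚ dℚ-isMetric)
    small-deficit : ∑[ y < suc m ] deficit y ≤ suc m
    small-deficit = ≤-trans ∑-deficit (≤-trans (K*2^K≤2^[K+K] K) 4^K≤n)
    cost-p : suc m * K ≤ ∑[ y < suc m ] d p y + suc m
    cost-p = ≤-trans cost-output (+-monoʳ-≤ (∑[ y < suc m ] d p y) small-deficit)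
    cost-q : ∑[ y < suc m ] d q y ≤ (6 + 4 * c) * suc m
    cost-q = ≤-trans cost-median (≤-trans
      (*-monoʳ-≤ 2 (+-mono-≤ (+-monoʳ-≤ (suc m * 2) (*-monoʳ-≤ 2 few-rounds)) small-deficit))
      (≤-reflexive (collect (suc m) c)))
    cost≡ : cost dℚ (run alg dℚ) ≡ toℚ (∑[ y < suc m ] d p y)
    cost≡ = trans (cong (cost dℚ) (proj₁ d-consistent)) (sumFin-toℚ (d p))
    opt≤ : opt dℚ ℚ.≤ toℚ (∑[ y < suc m ] d q y)
    opt≤ = subst (opt dℚ ℚ.≤_) (sumFin-toℚ (d q)) (minFin≤ (cost dℚ) q)
    ratio : δ c ℚ.* logℚ (suc m) ℚ.* opt dℚ ℚ.< cost dℚ (run alg dℚ)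
    ratio = subst₂ (λ l t → δ c ℚ.* l ℚ.* opt dℚ ℚ.< t) (sym (/1≡toℚ ⌈log₂ suc m ⌉)) (sym cost≡)
      (1/1+-scaled-< (24 + 16 * c) ⌈log₂ suc m ⌉ (∑[ y < suc m ] d q y) (∑[ y < suc m ] d p y) (opt dℚ) opt≤
        (cost-ratio {c = c} (s≤s z≤n) K≥3 cost-p cost-q (n<2^k⇒⌈log₂n⌉≤k (suc K + suc K) n<4^[1+K])))

  lower-bound : (A : (n : ℕ) → .{{_ : NonZero n}} → QueryAlg n) (c n₀ : ℕ) →
                (∀ (n : ℕ) .{{_ : NonZero n}} → n₀ ≤ n →
                   (d : Fin n → Fin n → ℚ) → IsMetric d → queries (A n) d ≤ c * n) →
                ∀ (n : ℕ) .{{_ : NonZero n}} → n₀ + 64 ≤ n →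
                ∃[ d ] IsMetric d × δ c ℚ.* logℚ n ℚ.* opt d ℚ.< cost d (run (A n) d)
  lower-bound A c n₀ linear (suc m) N≤n =
    adversary-wins m c (A (suc m)) (≤-trans (m≤n+m 64 n₀) N≤n) (linear (suc m) (≤-trans (m≤m+n n₀ 64) N≤n))

open import Data.Nat using (ℕ; NonZero) renaming (_≤_ to _≤ₙ_; _*_ to _*ₙ_)
open import Data.Fin using (Fin)
open import Data.Rational using (ℚ; 0ℚ; _<_; _*_)
open import Data.Product using (∃-syntax; _×_)
open import Data.Nat using (_+_)
open import Data.Product using (_,_)

theorem18 : (A : (n : ℕ) → .{{_ : NonZero n}} → QueryAlg n)
    → (∃[ c ] ∃[ n₀ ] ∀ (n : ℕ) .{{_ : NonZero n}} → n₀ ≤ₙ n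
         → (d : Fin n → Fin n → ℚ) → IsMetric d → queries (A n) d ≤ₙ c *ₙ n)
    → ∃[ δ ] (0ℚ < δ) × (∃[ N ] ∀ (n : ℕ) .{{_ : NonZero n}} → N ≤ₙ n
         → ∃[ d ] (IsMetric d × (δ * logℚ n * opt d < cost d (run (A n) d))))
theorem18 A (c , n₀ , linear) = δ c , δ-positive c , n₀ + 64 , lower-bound A c n₀ linear
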